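{- Let $\alpha=(x_1,\dots,x_{12})\in\mathbb{N}^{12}$ be a magic distinct labelling of the cube. Then there is a unique automorphism $u\in U$ such that the transformed labelling $u\cdot\alpha=(y_1,\dots,y_{12})$ is of one of the following two types: (i) $y_1$ is the smallest label and $y_6$ is the second smallest label; (ii) $y_1$ is the smallest label, $y_4$ is the second smallest label, and $y_6<y_7$.
   Context: The cube graph has 8 vertices and 12 edges numbered $1,\dots,12$ so that the eight vertices are incident to the edge sets $\{1,2,9\},\{1,3,10\},\{2,4,12\},\{3,4,11\},\{5,6,9\},\{5,7,10\},\{6,8,12\},\{7,8,11\}$. A magic labelling assigns $x_i\in\mathbb{N}$ to edge $i$ such that the sum of the three labels at each vertex is the same number $r$; it is a magic distinct labelling if $x_1,\dots,x_{12}$ are pairwise distinct. $U$ is the automorphism group of the cube graph (permutations of vertices preserving adjacency; $|U|=48$), acting on the edges; each $u\in U$ induces a permutation $\sigma_u$ of $\{1,\dots,12\}$, and $u\cdot\alpha$ is the labelling with $(u\cdot\alpha)_{\sigma_u(j)}=x_j$ for all $j$. -}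

module Defs where

open import Data.Nat using (ℕ; _+_; _<_)
open import Data.Fin using (Fin; zero; suc; _≟_)
open import Data.Fin using (#_)
open import Data.List using (List; []; _∷_; allFin; map)
open import Data.Bool.ListAction using (any; all)
open import Data.Nat.ListAction using (sum)
open import Data.Bool using (Bool; true; false; if_then_else_; not; _∨_)
open import Data.Product using (Σ; ∃; _×_; _,_)
open import Relation.Nullary using (¬_; does)
open import Relation.Binary.PropositionalEquality using (_≡_; _≢_)
open import Function.Definitions using (Injective)
open import Function.Bundles using (_⇔_)
open import Data.List.Membership.Propositional using (_∈_)

-- Vertices of the cube: Fin 8.  Edges: Fin 12, where paper edge i is (i - 1).
Vertex : Set
Vertex = Fin 8

Edge : Set
Edge = Fin 12

inc : Vertex → List Edge
inc zero = # 0 ∷ # 1 ∷ # 8 ∷ []                                                  -- {1,2,9}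
inc (suc zero) = # 0 ∷ # 2 ∷ # 9 ∷ []                                            -- {1,3,10}
inc (suc (suc zero)) = # 1 ∷ # 3 ∷ # 11 ∷ []                                     -- {2,4,12}
inc (suc (suc (suc zero))) = # 2 ∷ # 3 ∷ # 10 ∷ []                               -- {3,4,11}
inc (suc (suc (suc (suc zero)))) = # 4 ∷ # 5 ∷ # 8 ∷ []                          -- {5,6,9}
inc (suc (suc (suc (suc (suc zero))))) = # 4 ∷ # 6 ∷ # 9 ∷ []                    -- {5,7,10}
inc (suc (suc (suc (suc (suc (suc zero)))))) = # 5 ∷ # 7 ∷ # 11 ∷ []             -- {6,8,12}
inc (suc (suc (suc (suc (suc (suc (suc zero))))))) = # 6 ∷ # 7 ∷ # 10 ∷ []       -- {7,8,11}

Adj : Vertex → Vertex → Set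
Adj v w = v ≢ w × ∃ λ (e : Edge) → e ∈ inc v × e ∈ inc w

-- u is a graph automorphism: a permutation of the vertices (injective on a
-- finite set) preserving adjacency in both directions.
IsAut : (Vertex → Vertex) → Set
IsAut u = Injective _≡_ _≡_ u × (∀ v w → Adj v w ⇔ Adj (u v) (u w))

memb : Edge → List Edge → Bool
memb e l = any (λ f → does (e ≟ f)) l

firstSat : ∀ {n} → (Fin n → Bool) → Fin n → Fin n
firstSat {n} p d = go (allFin n)
  where
  go : List (Fin n) → Fin n
  go [] = d
  go (k ∷ ks) = if p k then k else go ks

-- σ_u(j): the edge k whose endpoints are the images under u of the endpoints
-- of j, i.e. k is incident to u v for every vertex v incident to j.
-- (For an automorphism this edge exists and is unique; the default j is never used.)
σ : (Vertex → Vertex) → Edge → Edge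
σ u j = firstSat (λ k → all (λ v → not (memb j (inc v)) ∨ memb k (inc (u v))) (allFin 8)) j

-- u · α : the labelling y with y (σ_u j) = x j, i.e. y k = x (σ_u⁻¹ k).
act : (Vertex → Vertex) → (Edge → ℕ) → (Edge → ℕ)
act u x k = x (firstSat (λ j → does (σ u j ≟ k)) k)

vsum : (Edge → ℕ) → Vertex → ℕ
vsum x v = sum (map x (inc v))

IsMagic : (Edge → ℕ) → Set
IsMagic x = ∃ λ r → ∀ v → vsum x v ≡ r

IsMagicDistinct : (Edge → ℕ) → Set
IsMagicDistinct x = IsMagic x × (∀ i j → x i ≡ x j → i ≡ j)

SmallestAt1 : (Edge → ℕ) → Set
SmallestAt1 y = ∀ k → k ≢ # 0 → y (# 0) < y k

SecondSmallestAt : Edge → (Edge → ℕ) → Set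
SecondSmallestAt s y = ∀ k → k ≢ # 0 → k ≢ s → y s < y k

TypeI : (Edge → ℕ) → Set
TypeI y = SmallestAt1 y × SecondSmallestAt (# 5) y

TypeII : (Edge → ℕ) → Set
TypeII y = SmallestAt1 y × SecondSmallestAt (# 3) y × y (# 5) < y (# 6)

-- The least label of α sits on an edge m and the second least on an edge s ≠ m.  An automorphism u
-- permutes the edges by σ_u, and u · α is of type (i) exactly when σ_u⁻¹ takes the edges 1 and 6 to
-- m and s, of type (ii) exactly when it takes 1 and 4 to m and s and y₆ < y₇.  Two distinct edges of
-- the cube are adjacent, antipodal, skew, or opposite in a face.  If m and s are adjacent or
-- antipodal, two vertex configurations of equal size whose edge multisets differ by {m, s} versus
-- two other edges {c, d} have equal label sums, so x_m + x_s = x_c + x_d, which minimality forbids.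
-- Ordered skew pairs form a single orbit with trivial stabiliser, that of (1, 6); ordered pairs of
-- opposite edges of a face form the orbit of (1, 4), whose stabiliser is the reflection exchanging
-- the edges 6 and 7, and exactly one of the two choices has y₆ < y₇.  These facts about the cube
-- group are checked by evaluation over an explicit list of 48 automorphisms, which a backtracking
-- search shows to be complete.

module Submission where

open import Defs
open import Data.Nat using (ℕ)
open import Data.Product using (∃; _×_)
open import Data.Sum using (_⊎_)
open import Relation.Binary.PropositionalEquality using (_≡_)

open import Data.Bool as Bool using (Bool; true; _∧_; not; _∨_; if_then_else_; T?)
open import Data.Bool.ListAction using (all; and)
open import Data.Empty using (⊥; ⊥-elim)
open import Data.Fin as Fin using (Fin; #_; punchIn; punchOut)
open import Data.Fin.Properties as Finₚ using (punchInᵢ≢i; punchIn-punchOut; punchIn-injective)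
open import Data.List using (List; []; _∷_; _++_; map; concatMap; allFin; filter; length; reverse; reverseAcc; foldr)
open import Data.List.Properties using (map-++; map-cong; ∷-injective)
open import Data.List.Extrema.Nat using (argmin; f[argmin]≤f[xs])
open import Data.List.Membership.Propositional using (_∈_; find; lose)
open import Data.List.Membership.Propositional.Properties using (∈-allFin; ∈-map⁻; ∈-concatMap⁺; ∈-∃++)
open import Data.List.Relation.Binary.Permutation.Propositional using (_↭_; prep; ↭-refl; ↭-sym; ↭-trans)
import Data.List.Relation.Binary.Permutation.Propositional.Properties as ↭
open import Data.List.Relation.Unary.All as All using (All)
open import Data.List.Relation.Unary.Any as Any using (here; there)
open import Data.List.Relation.Unary.Any.Properties using (reverse⁺)
open import Data.Maybe as Maybe using (Maybe; just; nothing; _<∣>_; is-just; to-witness-T)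
open import Data.Nat as ℕ using (suc; _+_; _*_; _<_)
open import Data.Nat.DivMod using (_mod_)
open import Data.Nat.ListAction using (sum)
open import Data.Nat.ListAction.Properties using (sum-++; sum-↭)
open import Data.Nat.Properties using (<-asym; <-irrefl; <-cmp; ≤∧≢⇒<; +-mono-<; +-cancelˡ-≡; +-identityʳ)
open import Data.Product using (_,_; proj₁; proj₂; uncurry)
open import Data.Sum using (inj₁; inj₂; [_,_]′)
open import Data.Vec as Vec using (Vec; []; _∷_; lookup; tabulate)
open import Data.Vec.Properties using (≡-dec)
open import Function using (_∘_; id; case_of_)
open import Function.Bundles using (_⇔_; mk⇔; module Equivalence)
open import Relation.Binary.Definitions using (DecidableEquality; tri<; tri≈; tri>)
open import Relation.Binary.PropositionalEquality
  using (_≢_; refl; sym; trans; cong; cong₂; subst; subst₂; module ≡-Reasoning)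
open import Relation.Nullary using (Dec; yes; no; does; ¬?; _×-dec_; _⊎-dec_; _→-dec_)
open import Relation.Nullary.Decidable using (True; toWitness; from-yes; dec⇒maybe; map′; dec-true; does-⇔)
open import Data.List.Membership.DecPropositional (Fin._≟_ {12}) using (_∈?_)

open Equivalence using (to; from)

-- Least and second least labels

Least : {A : Set} → (A → ℕ) → A → Set
Least x m = ∀ k → k ≢ m → x m < x k

SecondLeast : {A : Set} → (A → ℕ) → A → A → Set
SecondLeast x m s = ∀ k → k ≢ m → k ≢ s → x s < x k

module _ {A : Set} (_≟_ : DecidableEquality A) {x : A → ℕ} where

  least-unique : ∀ {a b} → Least x a → Least x b → a ≡ b
  least-unique {a} {b} a-least b-least with a ≟ b
  ... | yes a≡b = a≡b
  ... | no a≢b = ⊥-elim (<-asym (a-least b (a≢b ∘ sym)) (b-least a a≢b))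

  secondLeast-unique : ∀ {m a b} → a ≢ m → b ≢ m → SecondLeast x m a → SecondLeast x m b → a ≡ b
  secondLeast-unique {a = a} {b} a≢m b≢m a-second b-second with a ≟ b
  ... | yes a≡b = a≡b
  ... | no a≢b = ⊥-elim (<-asym (a-second b b≢m (a≢b ∘ sym)) (b-second a a≢m a≢b))

least-two-sum< : ∀ {A : Set} {x : A → ℕ} {m s c d} → Least x m → SecondLeast x m s →
                 c ≢ m → d ≢ m → d ≢ s → x m + x s < x c + x d
least-two-sum< m-least s-second c≢m d≢m d≢s = +-mono-< (m-least _ c≢m) (s-second _ d≢m d≢s)

module _ {A : Set} {x y : A → ℕ} {π ρ : A → A} (y≗x∘π : ∀ a → y a ≡ x (π a))
         (π∘ρ : ∀ a → π (ρ a) ≡ a) (ρ∘π : ∀ a → ρ (π a) ≡ a) where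

  private
    π-injective : ∀ {a b} → π a ≡ π b → a ≡ b
    π-injective {a} {b} πa≡πb = trans (sym (ρ∘π a)) (trans (cong ρ πa≡πb) (ρ∘π b))

    ρ-avoids : ∀ {k a} → k ≢ π a → ρ k ≢ a
    ρ-avoids k≢πa ρk≡a = k≢πa (trans (sym (π∘ρ _)) (cong π ρk≡a))

    y∘ρ : ∀ k → y (ρ k) ≡ x k
    y∘ρ k = trans (y≗x∘π (ρ k)) (cong x (π∘ρ k))

  least-reindex : ∀ {i} → Least y i ⇔ Least x (π i)
  least-reindex {i} = mk⇔
    (λ least k k≢πi → subst₂ _<_ (y≗x∘π i) (y∘ρ k) (least (ρ k) (ρ-avoids k≢πi)))
    (λ least k k≢i → subst₂ _<_ (sym (y≗x∘π i)) (sym (y≗x∘π k)) (least (π k) (k≢i ∘ π-injective)))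

  secondLeast-reindex : ∀ {i j} → SecondLeast y i j ⇔ SecondLeast x (π i) (π j)
  secondLeast-reindex {i} {j} = mk⇔
    (λ second k k≢πi k≢πj → subst₂ _<_ (y≗x∘π j) (y∘ρ k) (second (ρ k) (ρ-avoids k≢πi) (ρ-avoids k≢πj)))
    (λ second k k≢i k≢j →
      subst₂ _<_ (sym (y≗x∘π j)) (sym (y≗x∘π k)) (second (π k) (k≢i ∘ π-injective) (k≢j ∘ π-injective)))

least-exists : ∀ {n} (x : Fin (suc n) → ℕ) → (∀ i j → x i ≡ x j → i ≡ j) → ∃ (Least x)
least-exists {n} x x-injective = m , λ k k≢m →
  ≤∧≢⇒< (All.lookup (f[argmin]≤f[xs] {f = x} Fin.zero (allFin (suc n))) (∈-allFin k)) (k≢m ∘ sym ∘ x-injective m k)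
  where m = argmin x Fin.zero (allFin (suc n))

secondLeast-exists : ∀ {n} (x : Fin (suc (suc n)) → ℕ) → (∀ i j → x i ≡ x j → i ≡ j) →
                     ∀ m → ∃ λ s → s ≢ m × SecondLeast x m s
secondLeast-exists x x-injective m =
  let s , s-least = least-exists (x ∘ punchIn m) (λ i j → punchIn-injective m i j ∘ x-injective _ _)
      second : SecondLeast x m (punchIn m s)
      second k k≢m k≢s =
        let m≢k = k≢m ∘ sym
        in subst (x (punchIn m s) <_) (cong x (punchIn-punchOut m≢k))
             (s-least (punchOut m≢k) (λ k′≡s → k≢s (trans (sym (punchIn-punchOut m≢k)) (cong (punchIn m) k′≡s))))
  in punchIn m s , punchInᵢ≢i m s , second

-- Balanced vertex configurations

incidentEdges : List Vertex → List Edge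
incidentEdges = concatMap inc

module _ (x : Edge → ℕ) where

  sum-map-++ : ∀ es fs → sum (map x (es ++ fs)) ≡ sum (map x es) + sum (map x fs)
  sum-map-++ es fs = trans (cong sum (map-++ x es fs)) (sum-++ (map x es) (map x fs))

  sum-incidentEdges : ∀ {r} → (∀ v → vsum x v ≡ r) → ∀ vs → sum (map x (incidentEdges vs)) ≡ length vs * r
  sum-incidentEdges magic [] = refl
  sum-incidentEdges magic (v ∷ vs) =
    trans (sum-map-++ (inc v) (incidentEdges vs)) (cong₂ _+_ (magic v) (sum-incidentEdges magic vs))

  balanced-sums : ∀ {r ps qs es fs} → (∀ v → vsum x v ≡ r) → length ps ≡ length qs →
                  incidentEdges ps ++ es ↭ incidentEdges qs ++ fs → sum (map x es) ≡ sum (map x fs)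
  balanced-sums {r} {ps} {qs} {es} {fs} magic same-size balanced = +-cancelˡ-≡ (length qs * r) _ _ (begin
    length qs * r + sum (map x es)                    ≡⟨ cong (λ n → n * r + sum (map x es)) same-size ⟨
    length ps * r + sum (map x es)                    ≡⟨ cong (_+ sum (map x es)) (sum-incidentEdges magic ps) ⟨
    sum (map x (incidentEdges ps)) + sum (map x es)   ≡⟨ sum-map-++ (incidentEdges ps) es ⟨
    sum (map x (incidentEdges ps ++ es))              ≡⟨ sum-↭ (↭.map⁺ x balanced) ⟩
    sum (map x (incidentEdges qs ++ fs))              ≡⟨ sum-map-++ (incidentEdges qs) fs ⟩
    sum (map x (incidentEdges qs)) + sum (map x fs)   ≡⟨ cong (_+ sum (map x fs)) (sum-incidentEdges magic qs) ⟩
    length qs * r + sum (map x fs)                    ∎)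
    where open ≡-Reasoning

record Exclusion (m s : Edge) : Set where
  field
    lhs rhs : List Vertex
    c d : Edge
    same-size : length lhs ≡ length rhs
    balanced : incidentEdges lhs ++ c ∷ d ∷ [] ↭ incidentEdges rhs ++ m ∷ s ∷ []
    c≢m : c ≢ m
    d≢m : d ≢ m
    d≢s : d ≢ s

exclusion-impossible : ∀ {x m s} → IsMagic x → Least x m → SecondLeast x m s → Exclusion m s → ⊥
exclusion-impossible {x} {m} {s} (r , magic) m-least s-second e =
  <-irrefl (sym sums) (least-two-sum< m-least s-second c≢m d≢m d≢s)
  where
  open Exclusion e
  sums : x c + x d ≡ x m + x s
  sums = subst₂ (λ a b → x c + a ≡ x m + b) (+-identityʳ (x d)) (+-identityʳ (x s))
           (balanced-sums x {ps = lhs} {rhs} magic same-size balanced)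

-- The automorphism group of the cube

adj? : (v w : Vertex) → Dec (Adj v w)
adj? v w = ¬? (v Fin.≟ w) ×-dec map′ (λ shared → let e , e∈v , e∈w = find shared in e , e∈v , e∈w)
                                     (λ (e , e∈v , e∈w) → lose e∈v e∈w) (Any.any? (_∈? inc w) (inc v))

_⇔?_ : {P Q : Set} → Dec P → Dec Q → Dec (P ⇔ Q)
p? ⇔? q? = map′ (uncurry mk⇔) (λ p⇔q → to p⇔q , from p⇔q) ((p? →-dec q?) ×-dec (q? →-dec p?))

isAut? : (u : Vertex → Vertex) → Dec (IsAut u)
isAut? u = map′ (λ (inj , iso) → (λ {v} {w} → inj v w) , iso) (λ (inj , iso) → (λ v w → inj) , iso)
  ((Finₚ.all? λ v → Finₚ.all? λ w → (u v Fin.≟ u w) →-dec (v Fin.≟ w)) ×-dec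
   (Finₚ.all? λ v → Finₚ.all? λ w → adj? v w ⇔? adj? (u v) (u w)))

Perm : Set
Perm = Vec Vertex 8

-- Listed in the order in which `extensions` below finds them.
automorphisms : List Perm
automorphisms = map (Vec.map (_mod 8)) (
    (0 ∷ 1 ∷ 2 ∷ 3 ∷ 4 ∷ 5 ∷ 6 ∷ 7 ∷ []) ∷ (0 ∷ 1 ∷ 4 ∷ 5 ∷ 2 ∷ 3 ∷ 6 ∷ 7 ∷ []) ∷ (0 ∷ 2 ∷ 1 ∷ 3 ∷ 4 ∷ 6 ∷ 5 ∷ 7 ∷ []) ∷
    (0 ∷ 2 ∷ 4 ∷ 6 ∷ 1 ∷ 3 ∷ 5 ∷ 7 ∷ []) ∷ (0 ∷ 4 ∷ 1 ∷ 5 ∷ 2 ∷ 6 ∷ 3 ∷ 7 ∷ []) ∷ (0 ∷ 4 ∷ 2 ∷ 6 ∷ 1 ∷ 5 ∷ 3 ∷ 7 ∷ []) ∷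
    (1 ∷ 0 ∷ 3 ∷ 2 ∷ 5 ∷ 4 ∷ 7 ∷ 6 ∷ []) ∷ (1 ∷ 0 ∷ 5 ∷ 4 ∷ 3 ∷ 2 ∷ 7 ∷ 6 ∷ []) ∷ (1 ∷ 3 ∷ 0 ∷ 2 ∷ 5 ∷ 7 ∷ 4 ∷ 6 ∷ []) ∷
    (1 ∷ 3 ∷ 5 ∷ 7 ∷ 0 ∷ 2 ∷ 4 ∷ 6 ∷ []) ∷ (1 ∷ 5 ∷ 0 ∷ 4 ∷ 3 ∷ 7 ∷ 2 ∷ 6 ∷ []) ∷ (1 ∷ 5 ∷ 3 ∷ 7 ∷ 0 ∷ 4 ∷ 2 ∷ 6 ∷ []) ∷
    (2 ∷ 0 ∷ 3 ∷ 1 ∷ 6 ∷ 4 ∷ 7 ∷ 5 ∷ []) ∷ (2 ∷ 0 ∷ 6 ∷ 4 ∷ 3 ∷ 1 ∷ 7 ∷ 5 ∷ []) ∷ (2 ∷ 3 ∷ 0 ∷ 1 ∷ 6 ∷ 7 ∷ 4 ∷ 5 ∷ []) ∷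
    (2 ∷ 3 ∷ 6 ∷ 7 ∷ 0 ∷ 1 ∷ 4 ∷ 5 ∷ []) ∷ (2 ∷ 6 ∷ 0 ∷ 4 ∷ 3 ∷ 7 ∷ 1 ∷ 5 ∷ []) ∷ (2 ∷ 6 ∷ 3 ∷ 7 ∷ 0 ∷ 4 ∷ 1 ∷ 5 ∷ []) ∷
    (3 ∷ 1 ∷ 2 ∷ 0 ∷ 7 ∷ 5 ∷ 6 ∷ 4 ∷ []) ∷ (3 ∷ 1 ∷ 7 ∷ 5 ∷ 2 ∷ 0 ∷ 6 ∷ 4 ∷ []) ∷ (3 ∷ 2 ∷ 1 ∷ 0 ∷ 7 ∷ 6 ∷ 5 ∷ 4 ∷ []) ∷
    (3 ∷ 2 ∷ 7 ∷ 6 ∷ 1 ∷ 0 ∷ 5 ∷ 4 ∷ []) ∷ (3 ∷ 7 ∷ 1 ∷ 5 ∷ 2 ∷ 6 ∷ 0 ∷ 4 ∷ []) ∷ (3 ∷ 7 ∷ 2 ∷ 6 ∷ 1 ∷ 5 ∷ 0 ∷ 4 ∷ []) ∷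
    (4 ∷ 0 ∷ 5 ∷ 1 ∷ 6 ∷ 2 ∷ 7 ∷ 3 ∷ []) ∷ (4 ∷ 0 ∷ 6 ∷ 2 ∷ 5 ∷ 1 ∷ 7 ∷ 3 ∷ []) ∷ (4 ∷ 5 ∷ 0 ∷ 1 ∷ 6 ∷ 7 ∷ 2 ∷ 3 ∷ []) ∷
    (4 ∷ 5 ∷ 6 ∷ 7 ∷ 0 ∷ 1 ∷ 2 ∷ 3 ∷ []) ∷ (4 ∷ 6 ∷ 0 ∷ 2 ∷ 5 ∷ 7 ∷ 1 ∷ 3 ∷ []) ∷ (4 ∷ 6 ∷ 5 ∷ 7 ∷ 0 ∷ 2 ∷ 1 ∷ 3 ∷ []) ∷
    (5 ∷ 1 ∷ 4 ∷ 0 ∷ 7 ∷ 3 ∷ 6 ∷ 2 ∷ []) ∷ (5 ∷ 1 ∷ 7 ∷ 3 ∷ 4 ∷ 0 ∷ 6 ∷ 2 ∷ []) ∷ (5 ∷ 4 ∷ 1 ∷ 0 ∷ 7 ∷ 6 ∷ 3 ∷ 2 ∷ []) ∷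
    (5 ∷ 4 ∷ 7 ∷ 6 ∷ 1 ∷ 0 ∷ 3 ∷ 2 ∷ []) ∷ (5 ∷ 7 ∷ 1 ∷ 3 ∷ 4 ∷ 6 ∷ 0 ∷ 2 ∷ []) ∷ (5 ∷ 7 ∷ 4 ∷ 6 ∷ 1 ∷ 3 ∷ 0 ∷ 2 ∷ []) ∷
    (6 ∷ 2 ∷ 4 ∷ 0 ∷ 7 ∷ 3 ∷ 5 ∷ 1 ∷ []) ∷ (6 ∷ 2 ∷ 7 ∷ 3 ∷ 4 ∷ 0 ∷ 5 ∷ 1 ∷ []) ∷ (6 ∷ 4 ∷ 2 ∷ 0 ∷ 7 ∷ 5 ∷ 3 ∷ 1 ∷ []) ∷
    (6 ∷ 4 ∷ 7 ∷ 5 ∷ 2 ∷ 0 ∷ 3 ∷ 1 ∷ []) ∷ (6 ∷ 7 ∷ 2 ∷ 3 ∷ 4 ∷ 5 ∷ 0 ∷ 1 ∷ []) ∷ (6 ∷ 7 ∷ 4 ∷ 5 ∷ 2 ∷ 3 ∷ 0 ∷ 1 ∷ []) ∷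
    (7 ∷ 3 ∷ 5 ∷ 1 ∷ 6 ∷ 2 ∷ 4 ∷ 0 ∷ []) ∷ (7 ∷ 3 ∷ 6 ∷ 2 ∷ 5 ∷ 1 ∷ 4 ∷ 0 ∷ []) ∷ (7 ∷ 5 ∷ 3 ∷ 1 ∷ 6 ∷ 4 ∷ 2 ∷ 0 ∷ []) ∷
    (7 ∷ 5 ∷ 6 ∷ 4 ∷ 3 ∷ 1 ∷ 2 ∷ 0 ∷ []) ∷ (7 ∷ 6 ∷ 3 ∷ 2 ∷ 5 ∷ 4 ∷ 1 ∷ 0 ∷ []) ∷ (7 ∷ 6 ∷ 5 ∷ 4 ∷ 3 ∷ 2 ∷ 1 ∷ 0 ∷ []) ∷ [])

forAll : {P : Perm → Set} (P? : ∀ g → Dec (P g)) → True (All.all? P? automorphisms) →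
         ∀ {g} → g ∈ automorphisms → P g
forAll P? holds = All.lookup (toWitness holds)

forAll₂ : {P : Perm → Perm → Set} (P? : ∀ g h → Dec (P g h)) →
          True (All.all? (λ g → All.all? (P? g) automorphisms) automorphisms) →
          ∀ {g h} → g ∈ automorphisms → h ∈ automorphisms → P g h
forAll₂ P? holds g∈ h∈ = All.lookup (forAll (λ g → All.all? (P? g) automorphisms) holds g∈) h∈

inverse : Perm → Perm
inverse g = tabulate (λ v → firstSat (λ w → does (lookup g w Fin.≟ v)) v)

endpoints : Edge → List Vertex
endpoints e = filter (λ v → e ∈? inc v) (allFin 8)

edgeThrough : List Vertex → Edge
edgeThrough vs = firstSat (λ e → all (λ v → memb e (inc v)) vs) (# 0)

image : Perm → Edge → Edge
image g e = edgeThrough (map (lookup g) (endpoints e))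

preimage : Perm → Edge → Edge
preimage g = image (inverse g)

firstPreimage : (Edge → Edge) → Edge → Edge
firstPreimage f k = firstSat (λ j → does (f j Fin.≟ k)) k

record CorrectEntry (g : Perm) : Set where
  field
    isAut : IsAut (lookup g)
    σ≗image : ∀ e → σ (lookup g) e ≡ image g e
    firstPreimage≗preimage : ∀ k → firstPreimage (image g) k ≡ preimage g k
    image∘preimage : ∀ k → image g (preimage g k) ≡ k
    preimage∘image : ∀ e → preimage g (image g e) ≡ e

correctEntry? : ∀ g → Dec (CorrectEntry g)
correctEntry? g = map′
  (λ (a , b , c , d , e) → record
    { isAut = a ; σ≗image = b ; firstPreimage≗preimage = c ; image∘preimage = d ; preimage∘image = e })
  (λ entry → let open CorrectEntry entry in isAut , σ≗image , firstPreimage≗preimage , image∘preimage , preimage∘image)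
  (isAut? (lookup g) ×-dec
   Finₚ.all? (λ e → σ (lookup g) e Fin.≟ image g e) ×-dec
   Finₚ.all? (λ k → firstPreimage (image g) k Fin.≟ preimage g k) ×-dec
   Finₚ.all? (λ k → image g (preimage g k) Fin.≟ k) ×-dec
   Finₚ.all? (λ e → preimage g (image g e) Fin.≟ e))

-- Proved by evaluation; abstract so that the evaluated proof terms are never unfolded afterwards.
abstract
  entry : ∀ {g} → g ∈ automorphisms → CorrectEntry g
  entry = forAll correctEntry? _

preimage-injective : ∀ {g} → g ∈ automorphisms → ∀ {i j} → preimage g i ≡ preimage g j → i ≡ j
preimage-injective {g} g∈ {i} {j} πi≡πj =
  trans (sym (image∘preimage i)) (trans (cong (image g) πi≡πj) (image∘preimage j))
  where open CorrectEntry (entry g∈)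

all-cong : ∀ {A : Set} {p q : A → Bool} → (∀ a → p a ≡ q a) → ∀ as → all p as ≡ all q as
all-cong p≗q as = cong and (map-cong p≗q as)

firstIn : (Edge → Bool) → Edge → List Edge → Edge
firstIn p d [] = d
firstIn p d (k ∷ ks) = if p k then k else firstIn p d ks

-- `firstSat p d` unfolds to `firstIn p d (allFin 12)`.
firstSat-cong : ∀ {p q : Edge → Bool} {d} → (∀ k → p k ≡ q k) → firstSat p d ≡ firstSat q d
firstSat-cong {p} {q} {d} p≗q = firstIn-cong (allFin 12)
  where
  firstIn-cong : ∀ ks → firstIn p d ks ≡ firstIn q d ks
  firstIn-cong [] = refl
  firstIn-cong (k ∷ ks) = cong₂ (λ b e → if b then k else e) (p≗q k) (firstIn-cong ks)

σ-cong : ∀ {u u′ : Vertex → Vertex} → (∀ v → u v ≡ u′ v) → ∀ j → σ u j ≡ σ u′ j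
σ-cong u≗u′ j = firstSat-cong λ k →
  all-cong (λ v → cong (λ w → not (memb j (inc v)) ∨ memb k (inc w)) (u≗u′ v)) (allFin 8)

firstPreimage-cong : ∀ {f f′ : Edge → Edge} → (∀ j → f j ≡ f′ j) → ∀ k → firstPreimage f k ≡ firstPreimage f′ k
firstPreimage-cong f≗f′ k = firstSat-cong λ j → cong (λ e → does (e Fin.≟ k)) (f≗f′ j)

act-table : ∀ {g u} (x : Edge → ℕ) → g ∈ automorphisms → (∀ v → u v ≡ lookup g v) →
            ∀ k → act u x k ≡ x (preimage g k)
act-table x g∈ u≗g k =
  cong x (trans (firstPreimage-cong (λ j → trans (σ-cong u≗g j) (σ≗image j)) k) (firstPreimage≗preimage k))
  where open CorrectEntry (entry g∈)

module Backtracking {A B : Set} (R : A → A → Bool) (S : B → B → Bool) (codomain : List B) where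

  Assignment : Set
  Assignment = List (A × B)

  consistent : A → B → Assignment → Bool
  consistent a b [] = true
  consistent a b ((a′ , b′) ∷ σ) = does (R a′ a Bool.≟ S b′ b) ∧ consistent a b σ

  extensions : List A → Assignment → List Assignment
  extensions [] σ = σ ∷ []
  extensions (a ∷ as) σ =
    concatMap (λ b → if consistent a b σ then extensions as ((a , b) ∷ σ) else []) codomain

  graph : (A → B) → List A → Assignment
  graph f = map (λ a → a , f a)

  graph-injective : ∀ {f f′ : A → B} as → graph f as ≡ graph f′ as → ∀ {a} → a ∈ as → f a ≡ f′ a
  graph-injective (a ∷ as) eq (here refl) = cong proj₂ (proj₁ (∷-injective eq))
  graph-injective (a ∷ as) eq (there a∈as) = graph-injective as (proj₂ (∷-injective eq)) a∈as

  module _ (f : A → B) (preserves : ∀ a a′ → R a a′ ≡ S (f a) (f a′)) (covers : ∀ b → b ∈ codomain) where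

    consistent-graph : ∀ a done → consistent a (f a) (graph f done) ≡ true
    consistent-graph a [] = refl
    consistent-graph a (a′ ∷ done) =
      cong₂ _∧_ (dec-true (R a′ a Bool.≟ S (f a′) (f a)) (preserves a′ a)) (consistent-graph a done)

    extensions-complete : ∀ as done → graph f (reverseAcc done as) ∈ extensions as (graph f done)
    extensions-complete [] done = here refl
    extensions-complete (a ∷ as) done = ∈-concatMap⁺ _ (Any.map (λ { refl → extend }) (covers (f a)))
      where
      extend : graph f (reverseAcc (a ∷ done) as) ∈
               (if consistent a (f a) (graph f done) then extensions as (graph f (a ∷ done)) else [])
      extend rewrite consistent-graph a done = extensions-complete as (a ∷ done)

adjacent : Vertex → Vertex → Bool
adjacent v w = does (adj? v w)

open Backtracking adjacent adjacent (allFin 8)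

automorphisms-enumerated : extensions (allFin 8) [] ≡ map (λ g → graph (lookup g) (reverse (allFin 8))) automorphisms
automorphisms-enumerated = refl

automorphisms-complete : ∀ u → IsAut u → ∃ λ g → g ∈ automorphisms × (∀ v → u v ≡ lookup g v)
automorphisms-complete u (_ , iso) =
  let g , g∈ , graphs≡ = ∈-map⁻ graphOf (subst (graph u vertices ∈_) automorphisms-enumerated
                                                  (extensions-complete u preserves ∈-allFin (allFin 8) []))
  in g , g∈ , λ v → graph-injective {u} {lookup g} vertices graphs≡ (reverse⁺ (∈-allFin v))
  where
  vertices : List Vertex
  vertices = reverse (allFin 8)
  graphOf : Perm → Assignment
  graphOf g = graph (lookup g) vertices

  preserves : ∀ v w → adjacent v w ≡ adjacent (u v) (u w)
  preserves v w = does-⇔ (iso v w) (adj? v w) (adj? (u v) (u w))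

-- Ordered pairs of edges

samePreimage? : ∀ g h k → Dec (preimage g k ≡ preimage h k)
samePreimage? g h k = preimage g k Fin.≟ preimage h k

abstract
  skew-rigid : ∀ {g h} → g ∈ automorphisms → h ∈ automorphisms →
               preimage g (# 0) ≡ preimage h (# 0) → preimage g (# 5) ≡ preimage h (# 5) → g ≡ h
  skew-rigid = forAll₂ (λ g h → samePreimage? g h (# 0) →-dec samePreimage? g h (# 5) →-dec ≡-dec Fin._≟_ g h) _

  faceOpposite-rigid : ∀ {g h} → g ∈ automorphisms → h ∈ automorphisms →
                       preimage g (# 0) ≡ preimage h (# 0) → preimage g (# 3) ≡ preimage h (# 3) →
                       g ≡ h ⊎ (preimage h (# 5) ≡ preimage g (# 6) × preimage h (# 6) ≡ preimage g (# 5))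
  faceOpposite-rigid = forAll₂ (λ g h → samePreimage? g h (# 0) →-dec samePreimage? g h (# 3) →-dec
    (≡-dec Fin._≟_ g h ⊎-dec (preimage h (# 5) Fin.≟ preimage g (# 6) ×-dec preimage h (# 6) Fin.≟ preimage g (# 5)))) _

  skew≢faceOpposite : ∀ {g h} → g ∈ automorphisms → h ∈ automorphisms →
                      preimage g (# 0) ≡ preimage h (# 0) → preimage g (# 3) ≢ preimage h (# 5)
  skew≢faceOpposite = forAll₂ (λ g h → samePreimage? g h (# 0) →-dec ¬? (preimage g (# 3) Fin.≟ preimage h (# 5))) _

  faceReflection : ∀ {g} → g ∈ automorphisms → ∃ λ h → h ∈ automorphisms ×
                   preimage h (# 0) ≡ preimage g (# 0) × preimage h (# 3) ≡ preimage g (# 3) ×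
                   preimage h (# 5) ≡ preimage g (# 6) × preimage h (# 6) ≡ preimage g (# 5)
  faceReflection g∈ = find (forAll (λ g → Any.any? (λ h →
    samePreimage? h g (# 0) ×-dec samePreimage? h g (# 3) ×-dec
    preimage h (# 5) Fin.≟ preimage g (# 6) ×-dec preimage h (# 6) Fin.≟ preimage g (# 5)) automorphisms) _ g∈)

permutation? : (es fs : List Edge) → Maybe (es ↭ fs)
permutation? [] [] = just ↭-refl
permutation? [] (_ ∷ _) = nothing
permutation? (e ∷ es) fs with e ∈? fs
... | no _ = nothing
... | yes e∈fs with ∈-∃++ e∈fs
...   | pre , post , refl =
  Maybe.map (λ es↭ → ↭-trans (prep e es↭) (↭-sym (↭.shift e pre post))) (permutation? es (pre ++ post))

data PairClass (m s : Edge) : Set where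
  skew : ∀ {g} → g ∈ automorphisms → preimage g (# 0) ≡ m → preimage g (# 5) ≡ s → PairClass m s
  faceOpposite : ∀ {g} → g ∈ automorphisms → preimage g (# 0) ≡ m → preimage g (# 3) ≡ s → PairClass m s
  excluded : Exclusion m s → PairClass m s

findAutomorphism : {P : Perm → Set} → (∀ g → Dec (P g)) → Maybe (∃ λ g → g ∈ automorphisms × P g)
findAutomorphism P? = Maybe.map find (dec⇒maybe (Any.any? P? automorphisms))

certify : ∀ m s (lhs rhs : List Vertex) (c d : Edge) → Maybe (Exclusion m s)
certify m s lhs rhs c d
  with length lhs ℕ.≟ length rhs | permutation? (incidentEdges lhs ++ c ∷ d ∷ []) (incidentEdges rhs ++ m ∷ s ∷ [])
     | c Fin.≟ m | d Fin.≟ m | d Fin.≟ s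
... | yes same-size | just balanced | no c≢m | no d≢m | no d≢s = just (record
  { lhs = lhs ; rhs = rhs ; c = c ; d = d ; same-size = same-size ; balanced = balanced
  ; c≢m = c≢m ; d≢m = d≢m ; d≢s = d≢s })
... | _ | _ | _ | _ | _ = nothing

-- Images under the automorphisms of two balanced configurations (numbered as in the paper): edge 9
-- joins vertices 1 and 5, so x₁ + x₂ = x₅ + x₆ for the adjacent edges 1, 2; the vertices 1, 7 against
-- 3, 5 give x₁ + x₈ = x₄ + x₅ for the antipodal edges 1, 8.
exclusion? : ∀ m s → Maybe (Exclusion m s)
exclusion? m s = foldr _<∣>_ nothing (concatMap candidates automorphisms)
  where
  candidates : Perm → List (Maybe (Exclusion m s))
  candidates g =
    certify m s (map (lookup g) (# 0 ∷ [])) (map (lookup g) (# 4 ∷ [])) (image g (# 4)) (image g (# 5)) ∷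
    certify m s (map (lookup g) (# 0 ∷ # 6 ∷ [])) (map (lookup g) (# 2 ∷ # 4 ∷ [])) (image g (# 3)) (image g (# 4)) ∷ []

classify? : ∀ m s → Maybe (PairClass m s)
classify? m s =
  Maybe.map (λ (_ , g∈ , e₀ , e₅) → skew g∈ e₀ e₅)
    (findAutomorphism λ g → preimage g (# 0) Fin.≟ m ×-dec preimage g (# 5) Fin.≟ s)
  <∣> Maybe.map (λ (_ , g∈ , e₀ , e₃) → faceOpposite g∈ e₀ e₃)
    (findAutomorphism λ g → preimage g (# 0) Fin.≟ m ×-dec preimage g (# 3) Fin.≟ s)
  <∣> Maybe.map excluded (exclusion? m s)

abstract
  classify : ∀ m s → m ≢ s → PairClass m s
  classify m s m≢s = to-witness-T (classify? m s) ([ ⊥-elim ∘ m≢s , id ]′ (classified m s))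
    where
    classified : ∀ m s → m ≡ s ⊎ Bool.T (is-just (classify? m s))
    classified = from-yes (Finₚ.all? λ m → Finₚ.all? λ s → m Fin.≟ s ⊎-dec T? (is-just (classify? m s)))

-- Normal forms

module NormalForm (x : Edge → ℕ) (x-injective : ∀ i j → x i ≡ x j → i ≡ j)
                  {m s : Edge} (m-least : Least x m) (s≢m : s ≢ m) (s-second : SecondLeast x m s) where

  Normalising : Perm → Set
  Normalising g = (preimage g (# 0) ≡ m × preimage g (# 5) ≡ s)
                ⊎ (preimage g (# 0) ≡ m × preimage g (# 3) ≡ s × x (preimage g (# 5)) < x (preimage g (# 6)))

  module _ {g : Perm} {y : Edge → ℕ} (g∈ : g ∈ automorphisms) (y≗x∘π : ∀ k → y k ≡ x (preimage g k)) where

    private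
      π : Edge → Edge
      π = preimage g
      open CorrectEntry (entry g∈)

      least-at : ∀ {i} → Least y i ⇔ Least x (π i)
      least-at = least-reindex {π = π} {ρ = image g} y≗x∘π preimage∘image image∘preimage

      secondLeast-at : ∀ {i j} → SecondLeast y i j ⇔ SecondLeast x (π i) (π j)
      secondLeast-at = secondLeast-reindex {π = π} {ρ = image g} y≗x∘π preimage∘image image∘preimage

    leastPair⇔ : ∀ {i j} → j ≢ i → (Least y i × SecondLeast y i j) ⇔ (π i ≡ m × π j ≡ s)
    leastPair⇔ {i} {j} j≢i = mk⇔ forward backward
      where
      forward : Least y i × SecondLeast y i j → π i ≡ m × π j ≡ s
      forward (i-least , j-second) = πi≡m , secondLeast-unique Fin._≟_ πj≢m s≢m
          (subst (λ a → SecondLeast x a (π j)) πi≡m (to secondLeast-at j-second))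
          s-second
        where
        πi≡m : π i ≡ m
        πi≡m = least-unique Fin._≟_ (to least-at i-least) m-least
        πj≢m : π j ≢ m
        πj≢m πj≡m = j≢i (preimage-injective g∈ (trans πj≡m (sym πi≡m)))
      backward : π i ≡ m × π j ≡ s → Least y i × SecondLeast y i j
      backward (πi≡m , πj≡s) =
        from least-at (subst (Least x) (sym πi≡m) m-least) ,
        from secondLeast-at (subst₂ (SecondLeast x) (sym πi≡m) (sym πj≡s) s-second)

    normal⇔normalising : (TypeI y ⊎ TypeII y) ⇔ Normalising g
    normal⇔normalising = mk⇔
      (λ { (inj₁ typeI) → inj₁ (to (leastPair⇔ λ ()) typeI)
         ; (inj₂ (least , second , y₅<y₆)) →
             let e₀ , e₃ = to (leastPair⇔ λ ()) (least , second)
             in inj₂ (e₀ , e₃ , subst₂ _<_ (y≗x∘π _) (y≗x∘π _) y₅<y₆) })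
      (λ { (inj₁ e) → inj₁ (from (leastPair⇔ λ ()) e)
         ; (inj₂ (e₀ , e₃ , x₅<x₆)) →
             let least , second = from (leastPair⇔ λ ()) (e₀ , e₃)
             in inj₂ (least , second , subst₂ _<_ (sym (y≗x∘π _)) (sym (y≗x∘π _)) x₅<x₆) })

  faceOpposite-normalising : ∀ {g} → g ∈ automorphisms → preimage g (# 0) ≡ m → preimage g (# 3) ≡ s →
                             ∃ λ h → h ∈ automorphisms × Normalising h
  faceOpposite-normalising {g} g∈ e₀ e₃ = case <-cmp (x (preimage g (# 5))) (x (preimage g (# 6))) of λ where
    (tri< x₅<x₆ _ _) → g , g∈ , inj₂ (e₀ , e₃ , x₅<x₆)
    (tri≈ _ x₅≡x₆ _) → case preimage-injective g∈ {# 5} {# 6} (x-injective _ _ x₅≡x₆) of λ ()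
    (tri> _ _ x₅>x₆) →
      let h , h∈ , h₀ , h₃ , h₅ , h₆ = faceReflection g∈
      in h , h∈ , inj₂ (trans h₀ e₀ , trans h₃ e₃ , subst₂ _<_ (cong x (sym h₅)) (cong x (sym h₆)) x₅>x₆)

  normalising-exists : IsMagic x → ∃ λ g → g ∈ automorphisms × Normalising g
  normalising-exists magic = case classify m s (s≢m ∘ sym) of λ where
    (skew g∈ e₀ e₅) → _ , g∈ , inj₁ (e₀ , e₅)
    (faceOpposite g∈ e₀ e₃) → faceOpposite-normalising g∈ e₀ e₃
    (excluded exclusion) → ⊥-elim (exclusion-impossible magic m-least s-second exclusion)

  normalising-unique : ∀ {g h} → g ∈ automorphisms → h ∈ automorphisms → Normalising g → Normalising h → g ≡ h
  normalising-unique g∈ h∈ (inj₁ (g₀ , g₅)) (inj₁ (h₀ , h₅)) = skew-rigid g∈ h∈ (trans g₀ (sym h₀)) (trans g₅ (sym h₅))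
  normalising-unique g∈ h∈ (inj₁ (g₀ , g₅)) (inj₂ (h₀ , h₃ , _)) =
    ⊥-elim (skew≢faceOpposite h∈ g∈ (trans h₀ (sym g₀)) (trans h₃ (sym g₅)))
  normalising-unique g∈ h∈ (inj₂ (g₀ , g₃ , _)) (inj₁ (h₀ , h₅)) =
    ⊥-elim (skew≢faceOpposite g∈ h∈ (trans g₀ (sym h₀)) (trans g₃ (sym h₅)))
  normalising-unique g∈ h∈ (inj₂ (g₀ , g₃ , g₅<g₆)) (inj₂ (h₀ , h₃ , h₅<h₆))
    with faceOpposite-rigid g∈ h∈ (trans g₀ (sym h₀)) (trans g₃ (sym h₃))
  ... | inj₁ g≡h = g≡h
  ... | inj₂ (h₅≡g₆ , h₆≡g₅) = ⊥-elim (<-asym g₅<g₆ (subst₂ _<_ (cong x h₅≡g₆) (cong x h₆≡g₅) h₅<h₆))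

proposition3p2 : (x : Edge → ℕ) → IsMagicDistinct x →
    ∃ λ (u : Vertex → Vertex) → IsAut u × (TypeI (act u x) ⊎ TypeII (act u x)) ×
    (∀ (u′ : Vertex → Vertex) → IsAut u′ → (TypeI (act u′ x) ⊎ TypeII (act u′ x)) →
    ∀ v → u′ v ≡ u v)
proposition3p2 x (magic , x-injective) =
  let m , m-least = least-exists x x-injective
      s , s≢m , s-second = secondLeast-exists x x-injective m
      open NormalForm x x-injective m-least s≢m s-second
      g , g∈ , g-normalising = normalising-exists magic
      unique : ∀ u′ → IsAut u′ → (TypeI (act u′ x) ⊎ TypeII (act u′ x)) → ∀ v → u′ v ≡ lookup g v
      unique u′ u′-aut u′-normal v =
        let h , h∈ , u′≗h = automorphisms-complete u′ u′-aut
            h-normalising = to (normal⇔normalising h∈ (act-table x h∈ u′≗h)) u′-normal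
        in trans (u′≗h v) (cong (λ t → lookup t v) (normalising-unique h∈ g∈ h-normalising g-normalising))
  in lookup g , CorrectEntry.isAut (entry g∈) ,
     from (normal⇔normalising g∈ (act-table x g∈ λ _ → refl)) g-normalising , unique
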